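{- Let $\Lambda\subseteq\mathbb{Z}^2$ be a lattice of rank 2 and let $\mathbf{v}\in\Lambda\cap\mathbb{N}^2$. There is a lattice path from the origin $\mathbf{0}$ to $\mathbf{v}$ such that no difference between two distinct nodes of the path (except $\mathbf{v}-\mathbf{0}$) lies in $\Lambda$ if and only if $\mathbf{v}$ is visible in $\Lambda$ and $\|\mathbf{v}\|_1\le\operatorname{vol}(\Lambda)$.
   Context: $\mathbb{N}=\{0,1,2,\dots\}$. A lattice path is a finite list of points of $\mathbb{N}^2$ such that the difference of any two consecutive points is $(1,0)$ or $(0,1)$. A point $\mathbf{v}\in\Lambda$ is visible in $\Lambda$ if the segment joining $\mathbf{0}$ and $\mathbf{v}$ contains no point of $\Lambda$ other than its endpoints. $\operatorname{vol}(\Lambda)$ is the covolume of $\Lambda$, i.e. the index $[\mathbb{Z}^2:\Lambda]$, and $\|\cdot\|_1$ is the $\ell^1$ norm. -}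

module Defs where

open import Data.Nat as ℕ using (ℕ; zero; suc)
open import Data.Integer as ℤ using (ℤ; +_)
open import Data.Fin using (Fin; fromℕ; inject₁) renaming (zero to fzero; suc to fsuc)
open import Data.Product using (_×_; _,_; Σ; ∃; ∃-syntax)
open import Data.Sum using (_⊎_)
open import Relation.Binary.PropositionalEquality using (_≡_; _≢_)

ℤ² : Set
ℤ² = ℤ × ℤ

ℕ² : Set
ℕ² = ℕ × ℕ

toℤ² : ℕ² → ℤ²
toℤ² (x , y) = (+ x , + y)

diff : ℕ² → ℕ² → ℤ²
diff (x , y) (x' , y') = (+ x ℤ.- + x' , + y ℤ.- + y')

record Lattice : Set where
  field
    b₁ b₂ : ℤ²
    det≢0 : ℤ.∣ (Data.Product.proj₁ b₁ ℤ.* Data.Product.proj₂ b₂)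
                ℤ.- (Data.Product.proj₂ b₁ ℤ.* Data.Product.proj₁ b₂) ∣ ≢ 0

open Lattice public

_∈L_ : ℤ² → Lattice → Set
(w₁ , w₂) ∈L Λ with b₁ Λ | b₂ Λ
... | (a₁ , a₂) | (c₁ , c₂) =
  ∃[ m ] ∃[ n ] (w₁ ≡ m ℤ.* a₁ ℤ.+ n ℤ.* c₁ × w₂ ≡ m ℤ.* a₂ ℤ.+ n ℤ.* c₂)

-- covolume = index [ℤ² : Λ] = |det(b₁, b₂)|
vol : Lattice → ℕ
vol Λ with b₁ Λ | b₂ Λ
... | (a₁ , a₂) | (c₁ , c₂) = ℤ.∣ a₁ ℤ.* c₂ ℤ.- a₂ ℤ.* c₁ ∣

‖_‖₁ : ℕ² → ℕ
‖ (x , y) ‖₁ = x ℕ.+ y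

-- w lies on the closed segment [0, v]: w = t·v for some rational t = k/n ∈ [0,1]
OnSegment : ℤ² → ℤ² → Set
OnSegment (w₁ , w₂) (v₁ , v₂) =
  ∃[ k ] ∃[ n ] (k ℕ.≤ n × 0 ℕ.< n ×
     + n ℤ.* w₁ ≡ + k ℤ.* v₁ × + n ℤ.* w₂ ≡ + k ℤ.* v₂)

Visible : Lattice → ℤ² → Set
Visible Λ v = ∀ w → w ∈L Λ → OnSegment w v → w ≡ (+ 0 , + 0) ⊎ w ≡ v

Step : ℕ² → ℕ² → Set
Step (x , y) q = q ≡ (suc x , y) ⊎ q ≡ (x , suc y)

IsLatticePath : (n : ℕ) → (Fin (suc n) → ℕ²) → Set
IsLatticePath n p = (i : Fin n) → Step (p (inject₁ i)) (p (fsuc i))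

GoodPath : Lattice → ℕ² → Set
GoodPath Λ v =
  ∃[ n ] Σ (Fin (suc n) → ℕ²) λ p →
    IsLatticePath n p × p fzero ≡ (0 , 0) × p (fromℕ n) ≡ v ×
    ((i j : Fin (suc n)) → i ≢ j → diff (p i) (p j) ∈L Λ →
       (i ≡ fzero × j ≡ fromℕ n) ⊎ (i ≡ fromℕ n × j ≡ fzero))

module Submission where

-- Necessity.  A walk of length n = ‖v‖₁ has n + 1 nodes in distinct classes
--   except 0 ≡ v, so pigeonhole gives n ≤ vol Λ.  If v = m·z with z ∈ Λ and
--   m ≥ 2, a discrete intermediate-value argument (universal chord theorem)
--   finds two nodes other than the ends differing by z; so v is visible.
--   Sufficiency.  The lower Christoffel walk keeps r = a·y - b·x in [0, a+b).
--   Two of its nodes differ by d with cross(v, d) = r_i - r_j, a multiple of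
--   det Λ smaller than vol Λ, hence 0; so d lies on [0, v] and visibility
--   leaves only d = v.

open import Defs
open import Data.Nat using (_≤_)
open import Data.Product using (_×_)
open import Function.Bundles using (_⇔_)

module Arithmetic where

  open import Data.Nat as ℕ using (ℕ; zero; suc)
  import Data.Nat.Properties as ℕP
  import Data.Nat.DivMod as ℕD
  import Data.Nat.Divisibility as ℕDiv
  open import Data.Nat.GCD using (gcd-GCD; module Bézout)
  open import Data.Integer using (+_; -[1+_]; 0ℤ; 1ℤ; -1ℤ; ∣_∣; _+_; _*_; _-_; -_)
  import Data.Integer.Properties as ℤP
  open import Data.Integer.GCD using (gcd)
  open import Data.Integer.Tactic.RingSolver using (solve-∀)
  open import Data.Product using (_×_; _,_; ∃-syntax)
  open import Data.Sum using (_⊎_; inj₁; inj₂)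
  open import Data.Empty using (⊥-elim)
  open import Relation.Binary.PropositionalEquality

  small-multiple : ∀ t d → ∣ t * d ∣ ℕ.< ∣ d ∣ → t * d ≡ 0ℤ
  small-multiple t d small = by-size ∣ t ∣ refl
    where
    by-size : ∀ k → ∣ t ∣ ≡ k → t * d ≡ 0ℤ
    by-size zero ∣t∣≡0 = cong (_* d) (ℤP.∣i∣≡0⇒i≡0 {t} ∣t∣≡0)
    by-size (suc k) ∣t∣≡ = ⊥-elim (ℕP.<⇒≱ small (begin
      ∣ d ∣             ≤⟨ ℕP.m≤m+n ∣ d ∣ (k ℕ.* ∣ d ∣) ⟩
      suc k ℕ.* ∣ d ∣   ≡⟨ cong (ℕ._* ∣ d ∣) ∣t∣≡ ⟨
      ∣ t ∣ ℕ.* ∣ d ∣   ≡⟨ ℤP.∣i*j∣≡∣i∣*∣j∣ t d ⟨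
      ∣ t * d ∣         ∎))
      where open ℕP.≤-Reasoning

  scale-injective : ∀ {n} p q → 0 ℕ.< n → + n * p ≡ + n * q → p ≡ q
  scale-injective {suc n} p q _ = ℤP.*-cancelˡ-≡ (+ suc n) p q

  scale-zero : ∀ {n} p → 0 ℕ.< n → + n * p ≡ 0ℤ → p ≡ 0ℤ
  scale-zero {n} p 0<n eq = scale-injective p 0ℤ 0<n (trans eq (sym (ℤP.*-zeroʳ (+ n))))

  pos-difference : ∀ {m n} → n ℕ.≤ m → + m - + n ≡ + (m ℕ.∸ n)
  pos-difference {m} {n} n≤m = trans (ℤP.[+m]-[+n]≡m⊖n m n) (ℤP.⊖-≥ n≤m)

  natural-factor : ∀ {m a} z → 0 ℕ.< m → + a ≡ + m * z → ∃[ z' ] (z ≡ + z' × a ≡ m ℕ.* z')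
  natural-factor {m} {a} (+ z') _ eq = z' , refl , ℤP.+-injective (trans eq (sym (ℤP.pos-* m z')))
  natural-factor {suc m} -[1+ z' ] _ ()

  sign-of : ∀ i → ∃[ σ ] (+ ∣ i ∣ ≡ σ * i)
  sign-of (+ n)    = 1ℤ , sym (ℤP.*-identityˡ (+ n))
  sign-of -[1+ n ] = -1ℤ , sym (ℤP.-1*i≡-i -[1+ n ])

  private
    cancel-law : ∀ p q → p ≡ (p + q) - q
    cancel-law = solve-∀

    bézout-law : ∀ x y σ τ i j → x * (σ * i) - y * (τ * j) ≡ (x * σ) * i + (- (y * τ)) * j
    bézout-law = solve-∀

    difference-of-sum : ∀ a b c → a ℕ.+ b ≡ c → + a ≡ + c - + b
    difference-of-sum a b c refl = trans (cancel-law (+ a) (+ b)) (cong (_- + b) (sym (ℤP.pos-+ a b)))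

  -- Bézout's identity over ℤ, from the natural-number version for ∣i∣, ∣j∣.
  bézout : ∀ i j → ∃[ x ] ∃[ y ] (gcd i j ≡ x * i + y * j)
  bézout i j with sign-of i | sign-of j | Bézout.identity (gcd-GCD ∣ i ∣ ∣ j ∣)
  ... | σ , σi | τ , τj | Bézout.+- x y eq = + x * σ , - (+ y * τ) , (begin
    gcd i j                                   ≡⟨ difference-of-sum _ _ _ eq ⟩
    + (x ℕ.* ∣ i ∣) - + (y ℕ.* ∣ j ∣)         ≡⟨ cong₂ _-_ (ℤP.pos-* x ∣ i ∣) (ℤP.pos-* y ∣ j ∣) ⟩
    + x * + ∣ i ∣ - + y * + ∣ j ∣             ≡⟨ cong₂ (λ p q → + x * p - + y * q) σi τj ⟩
    + x * (σ * i) - + y * (τ * j)             ≡⟨ bézout-law (+ x) (+ y) σ τ i j ⟩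
    (+ x * σ) * i + (- (+ y * τ)) * j         ∎)
    where open ≡-Reasoning
  ... | σ , σi | τ , τj | Bézout.-+ x y eq = - (+ x * σ) , + y * τ , (begin
    gcd i j                                   ≡⟨ difference-of-sum _ _ _ eq ⟩
    + (y ℕ.* ∣ j ∣) - + (x ℕ.* ∣ i ∣)         ≡⟨ cong₂ _-_ (ℤP.pos-* y ∣ j ∣) (ℤP.pos-* x ∣ i ∣) ⟩
    + y * + ∣ j ∣ - + x * + ∣ i ∣             ≡⟨ cong₂ (λ p q → + y * p - + x * q) τj σi ⟩
    + y * (τ * j) - + x * (σ * i)             ≡⟨ bézout-law (+ y) (+ x) τ σ j i ⟩
    (+ y * τ) * j + (- (+ x * σ)) * i         ≡⟨ ℤP.+-comm ((+ y * τ) * j) _ ⟩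
    (- (+ x * σ)) * i + (+ y * τ) * j         ∎)
    where open ≡-Reasoning

  digits-unique : ∀ γ .{{_ : ℕ.NonZero γ}} {r r' q q'} → r ℕ.< γ → r' ℕ.< γ →
                  r ℕ.+ q ℕ.* γ ≡ r' ℕ.+ q' ℕ.* γ → r ≡ r' × q ≡ q'
  digits-unique γ {r} {r'} {q} {q'} r<γ r'<γ eq = r≡r' , q≡q'
    where
    open ≡-Reasoning
    r≡r' : r ≡ r'
    r≡r' = begin
      r                        ≡⟨ ℕD.m<n⇒m%n≡m r<γ ⟨
      r ℕ.% γ                  ≡⟨ ℕD.[m+kn]%n≡m%n r q γ ⟨
      (r ℕ.+ q ℕ.* γ) ℕ.% γ    ≡⟨ cong (ℕ._% γ) eq ⟩
      (r' ℕ.+ q' ℕ.* γ) ℕ.% γ  ≡⟨ ℕD.[m+kn]%n≡m%n r' q' γ ⟩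
      r' ℕ.% γ                 ≡⟨ ℕD.m<n⇒m%n≡m r'<γ ⟩
      r'                       ∎
    q≡q' : q ≡ q'
    q≡q' = ℕP.*-cancelʳ-≡ q q' γ (ℕP.+-cancelˡ-≡ r _ _ (trans eq (cong (ℕ._+ q' ℕ.* γ) (sym r≡r'))))

  multiple-below : ∀ {n k} → n ℕDiv.∣ k → k ℕ.≤ n → k ≡ 0 ⊎ k ≡ n
  multiple-below (ℕDiv.divides zero k≡) _ = inj₁ k≡
  multiple-below {n} (ℕDiv.divides (suc q) k≡) k≤n =
    inj₂ (ℕP.≤-antisym k≤n (subst (n ℕ.≤_) (sym k≡) (ℕP.m≤m+n n (q ℕ.* n))))

module Lattices where

  open import Data.Nat as ℕ using (ℕ; suc)
  import Data.Nat.Properties as ℕP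
  import Data.Nat.Divisibility as ℕDiv
  open import Data.Nat.GCD using (gcd[m,n]∣m; gcd[m,n]∣n; gcd[m,n]≢0) renaming (gcd to gcdℕ)
  open import Data.Integer using (ℤ; +_; 0ℤ; 1ℤ; -1ℤ; ∣_∣; _+_; _*_; _-_; -_)
  import Data.Integer.Properties as ℤP
  open import Data.Integer.GCD using (gcd; gcd[i,j]∣i; gcd[i,j]∣j)
  open import Data.Integer.Divisibility.Signed using (∣ᵤ⇒∣; _∣_)
  open import Data.Integer.DivMod using (_/ℕ_; _%ℕ_; n%ℕd<d; a≡a%ℕn+[a/ℕn]*n)
  open import Data.Integer.Tactic.RingSolver using (solve-∀)
  open import Data.Product using (_×_; _,_; ∃-syntax; proj₁; proj₂)
  open import Data.Sum using (_⊎_; inj₁; inj₂)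
  import Data.Sum as Sum
  open import Data.Empty using (⊥-elim)
  open import Relation.Nullary using (yes; no)
  open import Relation.Binary.PropositionalEquality
  open Arithmetic

  infixl 6 _-²_
  -- Vector subtraction; diff p q is definitionally toℤ² p -² toℤ² q.
  _-²_ : ℤ² → ℤ² → ℤ²
  (w₁ , w₂) -² (u₁ , u₂) = (w₁ - u₁ , w₂ - u₂)

  cross : ℤ² → ℤ² → ℤ
  cross (w₁ , w₂) (u₁ , u₂) = w₁ * u₂ - w₂ * u₁

  det : Lattice → ℤ
  det Λ = cross (b₁ Λ) (b₂ Λ)

  private
    combination-law : ∀ k l m n m' n' x y →
      k * (m * x + n * y) + l * (m' * x + n' * y) ≡ (k * m + l * m') * x + (k * n + l * n') * y
    combination-law = solve-∀

    flip-law : ∀ w u → -1ℤ * (w - u) + 0ℤ * (w - u) ≡ u - w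
    flip-law = solve-∀

    cross-law : ∀ m n m' n' a₁ a₂ c₁ c₂ →
      (m * a₁ + n * c₁) * (m' * a₂ + n' * c₂) - (m * a₂ + n * c₂) * (m' * a₁ + n' * c₁)
        ≡ (m * n' - n * m') * (a₁ * c₂ - a₂ * c₁)
    cross-law = solve-∀

    first-law : ∀ a c → a ≡ 1ℤ * a + 0ℤ * c
    first-law = solve-∀

    second-law : ∀ a c → c ≡ 0ℤ * a + 1ℤ * c
    second-law = solve-∀

  module _ (Λ : Lattice) where

    ∈L-combination : ∀ (k l : ℤ) {w₁ w₂ u₁ u₂} → (w₁ , w₂) ∈L Λ → (u₁ , u₂) ∈L Λ →
                     (k * w₁ + l * u₁ , k * w₂ + l * u₂) ∈L Λ
    ∈L-combination k l (m , n , refl , refl) (m' , n' , refl , refl) =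
      k * m + l * m' , k * n + l * n' , combination-law k l m n m' n' _ _ , combination-law k l m n m' n' _ _

    ∈L-flip : ∀ w u → (w -² u) ∈L Λ → (u -² w) ∈L Λ
    ∈L-flip (w₁ , w₂) (u₁ , u₂) w-u∈ =
      subst₂ (λ x y → (x , y) ∈L Λ) (flip-law w₁ u₁) (flip-law w₂ u₂)
        (∈L-combination -1ℤ 0ℤ w-u∈ w-u∈)

    ∈L-basis₁ : b₁ Λ ∈L Λ
    ∈L-basis₁ = 1ℤ , 0ℤ , first-law (proj₁ (b₁ Λ)) (proj₁ (b₂ Λ)) , first-law (proj₂ (b₁ Λ)) (proj₂ (b₂ Λ))

    ∈L-basis₂ : b₂ Λ ∈L Λ
    ∈L-basis₂ = 0ℤ , 1ℤ , second-law (proj₁ (b₁ Λ)) (proj₁ (b₂ Λ)) , second-law (proj₂ (b₁ Λ)) (proj₂ (b₂ Λ))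

    cross-multiple : ∀ w u → w ∈L Λ → u ∈L Λ → ∃[ t ] (cross w u ≡ t * det Λ)
    cross-multiple _ _ (m , n , refl , refl) (m' , n' , refl , refl) =
      m * n' - n * m' , cross-law m n m' n' _ _ _ _

    small-cross : ∀ w u → w ∈L Λ → u ∈L Λ → ∣ cross w u ∣ ℕ.< vol Λ → cross w u ≡ 0ℤ
    small-cross w u w∈ u∈ small with cross-multiple w u w∈ u∈
    ... | t , eq = trans eq (small-multiple t (det Λ) (subst (λ z → ∣ z ∣ ℕ.< vol Λ) eq small))

  -- A basis of Λ in Hermite normal form: Λ contains (β, γ) and (α, 0) with
  -- γ·α = vol Λ.
  record TriangularBasis (Λ : Lattice) : Set where
    field
      γ α        : ℕ
      β          : ℤ
      vertical   : (β , + γ) ∈L Λ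
      horizontal : (+ α , 0ℤ) ∈L Λ
      index      : γ ℕ.* α ≡ vol Λ

  private
    det-law : ∀ a₁ c₁ A C g → a₁ * (C * g) - (A * g) * c₁ ≡ (C * a₁ - A * c₁) * g
    det-law = solve-∀

    horizontal-law₁ : ∀ σ A C a₁ c₁ → (σ * C) * a₁ + (σ * - A) * c₁ ≡ σ * (C * a₁ - A * c₁)
    horizontal-law₁ = solve-∀

    horizontal-law₂ : ∀ σ A C g → (σ * C) * (A * g) + (σ * - A) * (C * g) ≡ 0ℤ
    horizontal-law₂ = solve-∀

  -- γ is the gcd g of the second coordinates a₂ = A·g, c₂ = C·g of the basis,
  -- realised by a Bézout combination; C·b₁ - A·b₂ = (α₀, 0) with α₀·g = det Λ.
  triangularBasis : (Λ : Lattice) → TriangularBasis Λ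
  triangularBasis Λ = record
    { γ = ∣ g ∣ ; α = ∣ α₀ ∣ ; β = x * a₁ + y * c₁
    ; vertical = subst (λ z → (x * a₁ + y * c₁ , z) ∈L Λ) (sym gcd≡)
                   (∈L-combination Λ x y (∈L-basis₁ Λ) (∈L-basis₂ Λ))
    ; horizontal = subst₂ (λ p q → (p , q) ∈L Λ)
                     (trans (horizontal-law₁ σ A C a₁ c₁) (sym σα₀))
                     (trans (cong₂ (λ p q → (σ * C) * p + (σ * - A) * q) a₂≡ c₂≡)
                            (horizontal-law₂ σ A C g))
                     (∈L-combination Λ (σ * C) (σ * - A) (∈L-basis₁ Λ) (∈L-basis₂ Λ))
    ; index = begin
        ∣ g ∣ ℕ.* ∣ α₀ ∣    ≡⟨ ℕP.*-comm ∣ g ∣ ∣ α₀ ∣ ⟩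
        ∣ α₀ ∣ ℕ.* ∣ g ∣    ≡⟨ ℤP.∣i*j∣≡∣i∣*∣j∣ α₀ g ⟨
        ∣ α₀ * g ∣          ≡⟨ cong ∣_∣ det≡ ⟨
        vol Λ               ∎
    }
    where
    open ≡-Reasoning
    a₁ a₂ c₁ c₂ g x y : ℤ
    a₁ = proj₁ (b₁ Λ)
    a₂ = proj₂ (b₁ Λ)
    c₁ = proj₁ (b₂ Λ)
    c₂ = proj₂ (b₂ Λ)
    g = gcd a₂ c₂
    x = proj₁ (bézout a₂ c₂)
    y = proj₁ (proj₂ (bézout a₂ c₂))
    gcd≡ : g ≡ x * a₂ + y * c₂
    gcd≡ = proj₂ (proj₂ (bézout a₂ c₂))
    g∣a₂ : g ∣ a₂
    g∣a₂ = ∣ᵤ⇒∣ {g} {a₂} (gcd[i,j]∣i a₂ c₂)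
    g∣c₂ : g ∣ c₂
    g∣c₂ = ∣ᵤ⇒∣ {g} {c₂} (gcd[i,j]∣j a₂ c₂)
    A C α₀ : ℤ
    A = _∣_.quotient g∣a₂
    C = _∣_.quotient g∣c₂
    α₀ = C * a₁ - A * c₁
    a₂≡ : a₂ ≡ A * g
    a₂≡ = _∣_.equality g∣a₂
    c₂≡ : c₂ ≡ C * g
    c₂≡ = _∣_.equality g∣c₂
    det≡ : det Λ ≡ α₀ * g
    det≡ = trans (cong₂ (λ p q → a₁ * p - q * c₁) c₂≡ a₂≡) (det-law a₁ c₁ A C g)
    σ : ℤ
    σ = proj₁ (sign-of α₀)
    σα₀ : + ∣ α₀ ∣ ≡ σ * α₀
    σα₀ = proj₂ (sign-of α₀)

  -- ℤ²/Λ has at most vol Λ elements: reducing w by the triangular basis,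
  -- w = quot₂·(β, γ) + quot₁·(α, 0) + (rem₁, rem₂) with rem₁ < α, rem₂ < γ,
  -- gives a residue below vol Λ, and equal residues mean congruence modulo Λ.
  module Residues (Λ : Lattice) where
    open TriangularBasis (triangularBasis Λ)

    private instance
      γ≢0 : ℕ.NonZero γ
      γ≢0 = ℕP.m*n≢0⇒m≢0 γ {{subst ℕ.NonZero (sym index) (ℕ.≢-nonZero (det≢0 Λ))}}
      α≢0 : ℕ.NonZero α
      α≢0 = ℕP.m*n≢0⇒n≢0 γ {{subst ℕ.NonZero (sym index) (ℕ.≢-nonZero (det≢0 Λ))}}

    quot₂ quot₁ reduced₁ : ℤ² → ℤ
    quot₂ (w₁ , w₂) = w₂ /ℕ γ
    reduced₁ w = proj₁ w - quot₂ w * β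
    quot₁ w = reduced₁ w /ℕ α

    rem₂ rem₁ residue : ℤ² → ℕ
    rem₂ (w₁ , w₂) = w₂ %ℕ γ
    rem₁ w = reduced₁ w %ℕ α
    residue w = rem₂ w ℕ.+ rem₁ w ℕ.* γ

    residue<vol : ∀ w → residue w ℕ.< vol Λ
    residue<vol w@(w₁ , w₂) = begin-strict
      rem₂ w ℕ.+ rem₁ w ℕ.* γ   <⟨ ℕP.+-monoˡ-< (rem₁ w ℕ.* γ) (n%ℕd<d w₂ γ) ⟩
      suc (rem₁ w) ℕ.* γ        ≤⟨ ℕP.*-monoˡ-≤ γ (n%ℕd<d (reduced₁ w) α) ⟩
      α ℕ.* γ                   ≡⟨ ℕP.*-comm α γ ⟩
      γ ℕ.* α                   ≡⟨ index ⟩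
      vol Λ                     ∎
      where open ℕP.≤-Reasoning

    private
      split-law : ∀ w q b → w ≡ q * b + (w - q * b)
      split-law = solve-∀

      difference-law₁ : ∀ q b r t a q' t' → (q * b + (r + t * a)) - (q' * b + (r + t' * a))
                        ≡ (q - q') * b + (t - t') * a
      difference-law₁ = solve-∀

      difference-law₂ : ∀ r q g q' t t' → (r + q * g) - (r + q' * g) ≡ (q - q') * g + (t - t') * 0ℤ
      difference-law₂ = solve-∀

    decompose₁ : ∀ w → proj₁ w ≡ quot₂ w * β + (+ rem₁ w + quot₁ w * + α)
    decompose₁ w = trans (split-law (proj₁ w) (quot₂ w) β)
                         (cong (λ z → quot₂ w * β + z) (a≡a%ℕn+[a/ℕn]*n (reduced₁ w) α))

    decompose₂ : ∀ w → proj₂ w ≡ + rem₂ w + quot₂ w * + γ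
    decompose₂ (w₁ , w₂) = a≡a%ℕn+[a/ℕn]*n w₂ γ

    same-residue : ∀ w u → residue w ≡ residue u → (w -² u) ∈L Λ
    same-residue w@(w₁ , w₂) u@(u₁ , u₂) eq =
      subst₂ (λ p q → (p , q) ∈L Λ) (sym first) (sym second)
        (∈L-combination Λ (quot₂ w - quot₂ u) (quot₁ w - quot₁ u) vertical horizontal)
      where
      digits : rem₂ w ≡ rem₂ u × rem₁ w ≡ rem₁ u
      digits = digits-unique γ {rem₂ w} {rem₂ u} {rem₁ w} {rem₁ u} (n%ℕd<d w₂ γ) (n%ℕd<d u₂ γ) eq
      first : w₁ - u₁ ≡ (quot₂ w - quot₂ u) * β + (quot₁ w - quot₁ u) * + α
      first = trans (cong₂ _-_ (decompose₁ w)
                      (trans (decompose₁ u) (cong (λ r → quot₂ u * β + (+ r + quot₁ u * + α)) (sym (proj₂ digits)))))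
                    (difference-law₁ (quot₂ w) β (+ rem₁ w) (quot₁ w) (+ α) (quot₂ u) (quot₁ u))
      second : w₂ - u₂ ≡ (quot₂ w - quot₂ u) * + γ + (quot₁ w - quot₁ u) * 0ℤ
      second = trans (cong₂ _-_ (decompose₂ w)
                       (trans (decompose₂ u) (cong (λ r → + r + quot₂ u * + γ) (sym (proj₁ digits)))))
                     (difference-law₂ (+ rem₂ w) (quot₂ w) (+ γ) (quot₂ u) (quot₁ w) (quot₁ u))

  segment-of-origin : ∀ w → OnSegment w (+ 0 , + 0) → w ≡ (+ 0 , + 0)
  segment-of-origin (w₁ , w₂) (k , n , _ , 0<n , e₁ , e₂) =
    cong₂ _,_ (scale-zero w₁ 0<n (trans e₁ (ℤP.*-zeroʳ (+ k)))) (scale-zero w₂ 0<n (trans e₂ (ℤP.*-zeroʳ (+ k))))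

  segment-ends : ∀ {n k} v w → 0 ℕ.< n → + n * proj₁ w ≡ + k * proj₁ v → + n * proj₂ w ≡ + k * proj₂ v →
                 k ≡ 0 ⊎ k ≡ n → w ≡ (+ 0 , + 0) ⊎ w ≡ v
  segment-ends (v₁ , v₂) (w₁ , w₂) 0<n e₁ e₂ (inj₁ refl) =
    inj₁ (cong₂ _,_ (scale-zero w₁ 0<n (trans e₁ (ℤP.*-zeroˡ v₁))) (scale-zero w₂ 0<n (trans e₂ (ℤP.*-zeroˡ v₂))))
  segment-ends (v₁ , v₂) (w₁ , w₂) 0<n e₁ e₂ (inj₂ refl) =
    inj₂ (cong₂ _,_ (scale-injective w₁ v₁ 0<n e₁) (scale-injective w₂ v₂ 0<n e₂))

  private
    bézout-scaling-law₁ : ∀ n x y w v → n * (x * w + y * v) ≡ x * (n * w) + (y * n) * v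
    bézout-scaling-law₁ = solve-∀

    bézout-scaling-law₂ : ∀ n x y v k → x * (k * v) + (y * n) * v ≡ (x * k + y * n) * v
    bézout-scaling-law₂ = solve-∀

  bézout-scaling : ∀ n k x y w v → gcd (+ k) (+ n) ≡ x * + k + y * + n → + n * w ≡ + k * v →
                   + n * (x * w + y * v) ≡ gcd (+ k) (+ n) * v
  bézout-scaling n k x y w v g≡ nw≡kv = begin
    + n * (x * w + y * v)          ≡⟨ bézout-scaling-law₁ (+ n) x y w v ⟩
    x * (+ n * w) + (y * + n) * v  ≡⟨ cong (λ t → x * t + (y * + n) * v) nw≡kv ⟩
    x * (+ k * v) + (y * + n) * v  ≡⟨ bézout-scaling-law₂ (+ n) x y v (+ k) ⟩
    (x * + k + y * + n) * v        ≡⟨ cong (_* v) g≡ ⟨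
    gcd (+ k) (+ n) * v            ∎
    where open ≡-Reasoning

  -- If n·w = k·v for lattice points v, w and G = gcd(k, n) ≠ n, then
  -- v = m·z for the lattice point z = (G/n)·v and m = n/G ≥ 2.
  proper-divisor-point : ∀ Λ {n k} v w → v ∈L Λ → w ∈L Λ → 0 ℕ.< n →
    + n * proj₁ w ≡ + k * proj₁ v → + n * proj₂ w ≡ + k * proj₂ v → gcdℕ k n ≢ n →
    ∃[ m ] ∃[ z ] (2 ℕ.≤ m × z ∈L Λ × v ≡ (+ m * proj₁ z , + m * proj₂ z))
  proper-divisor-point Λ {n} {k} (v₁ , v₂) (w₁ , w₂) v∈ w∈ 0<n e₁ e₂ G≢n
    with bézout (+ k) (+ n) | gcd[m,n]∣n k n
  ... | x , y , g≡ | ℕDiv.divides m n≡mG =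
    m , (z₁ , z₂) , at-least-two m n≡mG , ∈L-combination Λ x y w∈ v∈ ,
    cong₂ _,_ (shrink z₁ v₁ (bézout-scaling n k x y w₁ v₁ g≡ e₁)) (shrink z₂ v₂ (bézout-scaling n k x y w₂ v₂ g≡ e₂))
    where
    G : ℕ
    G = gcdℕ k n
    z₁ z₂ : ℤ
    z₁ = x * w₁ + y * v₁
    z₂ = x * w₂ + y * v₂
    0<G : 0 ℕ.< G
    0<G = ℕP.n≢0⇒n>0 (gcd[m,n]≢0 k n (inj₂ (ℕP.>⇒≢ 0<n)))
    at-least-two : ∀ q → n ≡ q ℕ.* G → 2 ℕ.≤ q
    at-least-two 0 eq = ⊥-elim (ℕP.>⇒≢ 0<n eq)
    at-least-two 1 eq = ⊥-elim (G≢n (trans (sym (ℕP.+-identityʳ G)) (sym eq)))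
    at-least-two (suc (suc _)) _ = ℕ.s≤s (ℕ.s≤s ℕ.z≤n)
    shrink : ∀ t u → + n * t ≡ + G * u → u ≡ + m * t
    shrink t u eq = scale-injective u (+ m * t) 0<G (begin
      + G * u          ≡⟨ eq ⟨
      + n * t          ≡⟨ cong (λ r → + r * t) (trans n≡mG (ℕP.*-comm m G)) ⟩
      + (G ℕ.* m) * t  ≡⟨ cong (_* t) (ℤP.pos-* G m) ⟩
      + G * + m * t    ≡⟨ ℤP.*-assoc (+ G) (+ m) t ⟩
      + G * (+ m * t)  ∎)
      where open ≡-Reasoning

  segment-reduction : ∀ Λ v w → v ∈L Λ → w ∈L Λ → OnSegment w v →
    w ≡ (+ 0 , + 0) ⊎ w ≡ v ⊎ ∃[ m ] ∃[ z ] (2 ℕ.≤ m × z ∈L Λ × v ≡ (+ m * proj₁ z , + m * proj₂ z))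
  segment-reduction Λ v w v∈ w∈ (k , n , k≤n , 0<n , e₁ , e₂) with gcdℕ k n ℕ.≟ n
  ... | yes G≡n = Sum.map₂ inj₁ (segment-ends {n} {k} v w 0<n e₁ e₂
                    (multiple-below (subst (ℕDiv._∣ k) G≡n (gcd[m,n]∣m k n)) k≤n))
  ... | no G≢n = inj₂ (inj₂ (proper-divisor-point Λ {n} {k} v w v∈ w∈ 0<n e₁ e₂ G≢n))

module Walks where

  open import Data.Nat using (ℕ; zero; suc; _<_; _≤_; s≤s; z≤n)
  import Data.Nat.Properties as ℕP
  open import Data.Fin using (Fin; fromℕ; fromℕ<; inject₁; toℕ) renaming (zero to fzero; suc to fsuc)
  import Data.Fin.Properties as FinP
  open import Data.Product using (_,_; ∃-syntax; Σ)
  open import Data.Sum using (_⊎_; inj₁; inj₂)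
  open import Data.Empty using (⊥-elim)
  open import Relation.Binary.Definitions using (tri<; tri≈; tri>)
  open import Relation.Binary.PropositionalEquality
  open Lattices using (∈L-flip)

  record Walk (n : ℕ) (v : ℕ²) : Set where
    field
      node  : ℕ → ℕ²
      start : node 0 ≡ (0 , 0)
      stop  : node n ≡ v
      step  : ∀ i → i < n → Step (node i) (node (suc i))

  open Walk public

  Avoids : ∀ {n v} → Lattice → Walk n v → Set
  Avoids {n} Λ W = ∀ i j → j < i → i ≤ n → diff (node W i) (node W j) ∈L Λ → i ≡ n × j ≡ 0

  step-norm : ∀ p q → Step p q → ‖ q ‖₁ ≡ suc ‖ p ‖₁
  step-norm (x , y) _ (inj₁ refl) = refl
  step-norm (x , y) _ (inj₂ refl) = ℕP.+-suc x y

  norm-node : ∀ {n} (node : ℕ → ℕ²) → node 0 ≡ (0 , 0) →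
              (∀ i → i < n → Step (node i) (node (suc i))) → ∀ i → i ≤ n → ‖ node i ‖₁ ≡ i
  norm-node node start step zero _ = cong ‖_‖₁ start
  norm-node node start step (suc i) i<n =
    trans (step-norm (node i) (node (suc i)) (step i i<n))
          (cong suc (norm-node node start step i (ℕP.<⇒≤ i<n)))

  walk-length : ∀ {n v} (W : Walk n v) → n ≡ ‖ v ‖₁
  walk-length {n} W = trans (sym (norm-node (node W) (start W) (step W) n ℕP.≤-refl)) (cong ‖_‖₁ (stop W))

  walk⇒goodPath : ∀ {Λ n v} (W : Walk n v) → Avoids Λ W → GoodPath Λ v
  walk⇒goodPath {Λ} {n} W avoids = n , p , path , start W , trans (cong (node W) (FinP.toℕ-fromℕ n)) (stop W) , good
    where
    p : Fin (suc n) → ℕ²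
    p k = node W (toℕ k)

    path : IsLatticePath n p
    path i = subst (λ k → Step (node W k) (p (fsuc i))) (sym (FinP.toℕ-inject₁ i)) (step W (toℕ i) (FinP.toℕ<n i))

    last : ∀ {k} → toℕ k ≡ n → k ≡ fromℕ n
    last eq = FinP.toℕ-injective (trans eq (sym (FinP.toℕ-fromℕ n)))

    first : ∀ {k : Fin (suc n)} → toℕ k ≡ 0 → k ≡ fzero
    first = FinP.toℕ-injective

    good : (i j : Fin (suc n)) → i ≢ j → diff (p i) (p j) ∈L Λ →
           (i ≡ fzero × j ≡ fromℕ n) ⊎ (i ≡ fromℕ n × j ≡ fzero)
    good i j i≢j i-j∈ with ℕP.<-cmp (toℕ i) (toℕ j)
    ... | tri≈ _ eq _ = ⊥-elim (i≢j (FinP.toℕ-injective eq))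
    ... | tri> _ _ j<i with avoids (toℕ i) (toℕ j) j<i (FinP.toℕ≤pred[n] i) i-j∈
    ...   | i≡n , j≡0 = inj₂ (last i≡n , first j≡0)
    good i j i≢j i-j∈ | tri< i<j _ _ with avoids (toℕ j) (toℕ i) i<j (FinP.toℕ≤pred[n] j) (∈L-flip Λ (toℤ² (p i)) (toℤ² (p j)) i-j∈)
    ...   | j≡n , i≡0 = inj₁ (first i≡0 , last j≡n)

  goodPath⇒walk : ∀ {Λ v} → GoodPath Λ v → ∃[ n ] Σ (Walk n v) (Avoids Λ)
  goodPath⇒walk {Λ} {v} (n , p , path , p0 , pn , good) = n , W , avoids
    where
    cap : ℕ → Fin (suc n)
    cap i = fromℕ< (s≤s (ℕP.m⊓n≤n i n))

    toℕ-cap : ∀ {i} → i ≤ n → toℕ (cap i) ≡ i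
    toℕ-cap {i} i≤n = trans (FinP.toℕ-fromℕ< (s≤s (ℕP.m⊓n≤n i n))) (ℕP.m≤n⇒m⊓n≡m i≤n)

    cap-at : ∀ {i} (k : Fin (suc n)) → i ≤ n → toℕ k ≡ i → cap i ≡ k
    cap-at k i≤n eq = FinP.toℕ-injective (trans (toℕ-cap i≤n) (sym eq))

    W : Walk n v
    W = record
      { node  = λ i → p (cap i)
      ; start = trans (cong p (cap-at fzero z≤n refl)) p0
      ; stop  = trans (cong p (cap-at (fromℕ n) ℕP.≤-refl (FinP.toℕ-fromℕ n))) pn
      ; step  = λ i i<n → subst₂ Step
          (cong p (sym (cap-at (inject₁ (fromℕ< i<n)) (ℕP.<⇒≤ i<n)
                               (trans (FinP.toℕ-inject₁ (fromℕ< i<n)) (FinP.toℕ-fromℕ< i<n)))))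
          (cong p (sym (cap-at (fsuc (fromℕ< i<n)) i<n (cong suc (FinP.toℕ-fromℕ< i<n)))))
          (path (fromℕ< i<n))
      }

    avoids : Avoids Λ W
    avoids i j j<i i≤n i-j∈ = conclude (good (cap i) (cap j) cap-i≢cap-j i-j∈)
      where
      j≤n : j ≤ n
      j≤n = ℕP.≤-trans (ℕP.<⇒≤ j<i) i≤n
      cap-i≢cap-j : cap i ≢ cap j
      cap-i≢cap-j eq = ℕP.<⇒≢ j<i (sym (trans (sym (toℕ-cap i≤n)) (trans (cong toℕ eq) (toℕ-cap j≤n))))
      conclude : (cap i ≡ fzero × cap j ≡ fromℕ n) ⊎ (cap i ≡ fromℕ n × cap j ≡ fzero) → i ≡ n × j ≡ 0
      conclude (inj₁ (i≡0 , _)) = ⊥-elim (ℕP.n≮0 (subst (j <_) (trans (sym (toℕ-cap i≤n)) (cong toℕ i≡0)) j<i))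
      conclude (inj₂ (i≡n , j≡0)) =
        trans (sym (toℕ-cap i≤n)) (trans (cong toℕ i≡n) (FinP.toℕ-fromℕ n)) ,
        trans (sym (toℕ-cap j≤n)) (cong toℕ j≡0)

module DiscreteIVT where

  open import Data.Nat using (ℕ; zero; suc; _+_; _*_; _<_; _≤_; _≤′_; ≤′-refl; ≤′-step; s≤s; z≤n; _≤?_; _≟_)
  import Data.Nat.Properties as ℕP
  open import Data.Product using (_×_; _,_; ∃-syntax)
  open import Data.Sum using (_⊎_; inj₁; inj₂)
  open import Relation.Nullary using (yes; no)
  open import Function using (_∘_)
  open import Relation.Binary.PropositionalEquality

  UnitSteps : ℕ → (ℕ → ℕ) → Set
  UnitSteps h f = ∀ i → i < h → f (suc i) ≡ f i ⊎ f (suc i) ≡ suc (f i)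

  unitSteps-≤ : ∀ {h h' f} → h' ≤ h → UnitSteps h f → UnitSteps h' f
  unitSteps-≤ h'≤h steps i i<h' = steps i (ℕP.<-≤-trans i<h' h'≤h)

  private
    rises : ∀ {h f} → UnitSteps h f → ∀ i → i < h → f i ≤ f (suc i)
    rises steps i i<h with steps i i<h
    ... | inj₁ eq = ℕP.≤-reflexive (sym eq)
    ... | inj₂ eq = ℕP.≤-trans (ℕP.n≤1+n _) (ℕP.≤-reflexive (sym eq))

    rises-slowly : ∀ {h f} → UnitSteps h f → ∀ i → i < h → f (suc i) ≤ suc (f i)
    rises-slowly steps i i<h with steps i i<h
    ... | inj₁ eq = ℕP.≤-trans (ℕP.≤-reflexive eq) (ℕP.n≤1+n _)
    ... | inj₂ eq = ℕP.≤-reflexive eq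

  crossing : ∀ (D E : ℕ → ℕ) {lo hi} → lo ≤ hi → UnitSteps hi D → UnitSteps hi E →
             D lo ≤ E lo → E hi ≤ D hi → ∃[ j ] (j ≤ hi × D j ≡ E j)
  crossing D E {lo} lo≤hi stepsD stepsE Dlo≤Elo = go (ℕP.≤⇒≤′ lo≤hi) stepsD stepsE
    where
    -- descend from hi: as long as D ≠ E, the order E ≤ D persists one step down
    go : ∀ {hi} → lo ≤′ hi → UnitSteps hi D → UnitSteps hi E → E hi ≤ D hi → ∃[ j ] (j ≤ hi × D j ≡ E j)
    go ≤′-refl _ _ Elo≤Dlo = lo , ℕP.≤-refl , ℕP.≤-antisym Dlo≤Elo Elo≤Dlo
    go (≤′-step {hi} lo≤′hi) stepsD stepsE E≤D with D (suc hi) ≟ E (suc hi)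
    ... | yes meet = suc hi , ℕP.≤-refl , meet
    ... | no apart = widen (go lo≤′hi (unitSteps-≤ (ℕP.n≤1+n hi) stepsD) (unitSteps-≤ (ℕP.n≤1+n hi) stepsE) E≤D-before)
      where
      -- E rises and D rises by at most one, so E < D at hi + 1 gives E ≤ D at hi
      E≤D-before : E hi ≤ D hi
      E≤D-before = ℕP.≤-pred (begin
        suc (E hi)        ≤⟨ s≤s (rises stepsE hi ℕP.≤-refl) ⟩
        suc (E (suc hi))  ≤⟨ ℕP.≤∧≢⇒< E≤D (apart ∘ sym) ⟩
        D (suc hi)        ≤⟨ rises-slowly stepsD hi ℕP.≤-refl ⟩
        suc (D hi)        ∎)
        where open ℕP.≤-Reasoning
      widen : ∃[ j ] (j ≤ hi × D j ≡ E j) → ∃[ j ] (j ≤ suc hi × D j ≡ E j)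
      widen (j , j≤hi , meet) = j , ℕP.m≤n⇒m≤1+n j≤hi , meet

  crossing-below : ∀ (D E : ℕ → ℕ) {i i' B} → i ≤ B → i' ≤ B → UnitSteps B D → UnitSteps B E →
                   D i ≤ E i → E i' ≤ D i' → ∃[ j ] (j ≤ B × D j ≡ E j)
  crossing-below D E {i} {i'} i≤B i'≤B stepsD stepsE Di≤Ei Ei'≤Di' with ℕP.≤-total i i'
  ... | inj₁ i≤i' with crossing D E i≤i' (unitSteps-≤ i'≤B stepsD) (unitSteps-≤ i'≤B stepsE) Di≤Ei Ei'≤Di'
  ...   | j , j≤i' , meet = j , ℕP.≤-trans j≤i' i'≤B , meet
  crossing-below D E i≤B i'≤B stepsD stepsE Di≤Ei Ei'≤Di' | inj₂ i'≤i
    with crossing E D i'≤i (unitSteps-≤ i≤B stepsE) (unitSteps-≤ i≤B stepsD) Ei'≤Di' Di≤Ei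
  ...   | j , j≤i , meet = j , ℕP.≤-trans j≤i i≤B , sym meet

  private
    shift-summand : ∀ a b c → a + (c + b) ≡ (a + b) + c
    shift-summand a b c = trans (cong (a +_) (ℕP.+-comm c b)) (sym (ℕP.+-assoc a b c))

  step-at-most : ∀ (f : ℕ → ℕ) c k → f (suc k) ≤ f 0 + suc k * c → ∃[ t ] (t ≤ k × f (suc t) ≤ f t + c)
  step-at-most f c zero f1≤ = 0 , z≤n , subst (λ z → f 1 ≤ f 0 + z) (ℕP.+-identityʳ c) f1≤
  step-at-most f c (suc k) fm≤ with f (suc (suc k)) ≤? f (suc k) + c
  ... | yes small = suc k , ℕP.≤-refl , small
  ... | no big = later (step-at-most f c k (ℕP.+-cancelʳ-≤ c _ _ (ℕP.<⇒≤ before)))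
    where
    before : f (suc k) + c < f 0 + suc k * c + c
    before = ℕP.<-≤-trans (ℕP.≰⇒> big) (ℕP.≤-trans fm≤ (ℕP.≤-reflexive (shift-summand (f 0) (suc k * c) c)))
    later : ∃[ t ] (t ≤ k × f (suc t) ≤ f t + c) → ∃[ t ] (t ≤ suc k × f (suc t) ≤ f t + c)
    later (t , t≤k , small) = t , ℕP.m≤n⇒m≤1+n t≤k , small

  step-at-least : ∀ (f : ℕ → ℕ) c k → f 0 + suc k * c ≤ f (suc k) → ∃[ t ] (t ≤ k × f t + c ≤ f (suc t))
  step-at-least f c zero ≤f1 = 0 , z≤n , subst (λ z → f 0 + z ≤ f 1) (ℕP.+-identityʳ c) ≤f1
  step-at-least f c (suc k) ≤fm with f (suc k) + c ≤? f (suc (suc k))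
  ... | yes large = suc k , ℕP.≤-refl , large
  ... | no small = later (step-at-least f c k (ℕP.+-cancelʳ-≤ c _ _ (ℕP.<⇒≤ before)))
    where
    before : f 0 + suc k * c + c < f (suc k) + c
    before = ℕP.≤-<-trans (ℕP.≤-trans (ℕP.≤-reflexive (sym (shift-summand (f 0) (suc k * c) c))) ≤fm) (ℕP.≰⇒> small)
    later : ∃[ t ] (t ≤ k × f t + c ≤ f (suc t)) → ∃[ t ] (t ≤ suc k × f t + c ≤ f (suc t))
    later (t , t≤k , large) = t , ℕP.m≤n⇒m≤1+n t≤k , large

module Necessity where

  open import Data.Nat using (ℕ; zero; suc; _+_; _*_; _<_; _≤_; _≤?_; s≤s; z≤n)
  import Data.Nat.Properties as ℕP
  open import Data.Nat.Tactic.RingSolver using (solve-∀)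
  open import Data.Integer as ℤ using (+_)
  open import Data.Fin as Fin using (Fin; fromℕ<; toℕ)
  import Data.Fin.Properties as FinP
  open import Data.Product using (_×_; _,_; ∃₂; proj₁; proj₂)
  open import Data.Sum using (inj₁; inj₂)
  open import Data.Empty using (⊥; ⊥-elim)
  open import Relation.Nullary using (yes; no)
  open import Relation.Binary.PropositionalEquality
  open Arithmetic
  open Lattices
  open Walks
  open DiscreteIVT

  -- Pigeonhole: among the nodes 0, …, vol Λ two share a residue modulo Λ, so
  -- the walk cannot be longer than vol Λ.
  walk-bound : ∀ {Λ n v} (W : Walk n v) → Avoids Λ W → n ≤ vol Λ
  walk-bound {Λ} {n} W avoids with n ≤? vol Λ
  ... | yes n≤vol = n≤vol
  ... | no n≰vol = ⊥-elim (collision (FinP.pigeonhole (ℕP.n<1+n (vol Λ)) class))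
    where
    open Residues Λ
    point : Fin (suc (vol Λ)) → ℤ²
    point k = toℤ² (node W (toℕ k))
    class : Fin (suc (vol Λ)) → Fin (vol Λ)
    class k = fromℕ< (residue<vol (point k))
    toℕ-class : ∀ k → toℕ (class k) ≡ residue (point k)
    toℕ-class k = FinP.toℕ-fromℕ< (residue<vol (point k))
    collision : ∃₂ (λ i j → i Fin.< j × class i ≡ class j) → ⊥
    collision (i , j , i<j , same-class) = ℕP.<⇒≢ j<n (proj₁ (avoids (toℕ j) (toℕ i) i<j (ℕP.<⇒≤ j<n) j-i∈))
      where
      j<n : toℕ j < n
      j<n = ℕP.≤-<-trans (FinP.toℕ≤pred[n] j) (ℕP.≰⇒> n≰vol)
      same : residue (point j) ≡ residue (point i)
      same = trans (sym (toℕ-class j)) (trans (cong toℕ (sym same-class)) (toℕ-class i))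
      j-i∈ : diff (node W (toℕ j)) (node W (toℕ i)) ∈L Λ
      j-i∈ = same-residue (point j) (point i) same

  private
    distrib-law : ∀ m z₁ z₂ → m * z₁ + m * z₂ ≡ m * (z₁ + z₂)
    distrib-law = solve-∀

    shift-law : ∀ x y z₁ z₂ → (x + y) + (z₁ + z₂) ≡ (x + z₁) + (y + z₂)
    shift-law = solve-∀

  scaled-length : ∀ {n v} (W : Walk n v) m z₁ z₂ → v ≡ (m * z₁ , m * z₂) → n ≡ m * (z₁ + z₂)
  scaled-length W m z₁ z₂ refl = trans (walk-length W) (distrib-law m z₁ z₂)

  first-coordinate-steps : ∀ {n v} (W : Walk n v) → UnitSteps n (λ i → proj₁ (node W i))
  first-coordinate-steps W i i<n with step W i i<n
  ... | inj₁ right = inj₂ (cong proj₁ right)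
  ... | inj₂ up    = inj₁ (cong proj₁ up)

  record Chord {n v} (W : Walk n v) (z₁ z₂ : ℕ) : Set where
    field
      j       : ℕ
      fits    : j + (z₁ + z₂) ≤ n
      x-shift : proj₁ (node W (j + (z₁ + z₂))) ≡ proj₁ (node W j) + z₁
      y-shift : proj₂ (node W (j + (z₁ + z₂))) ≡ proj₂ (node W j) + z₂

  -- Proof: along the multiples of c = ‖z‖₁
  -- the first coordinate grows by (m+1)·z₁ in m+1 chunks, so one chunk grows by
  -- at most z₁ and another by at least z₁; in between, X(i + c) - X(i) = z₁.
  module _ {n v} (W : Walk n v) (m z₁ z₂ : ℕ) (v≡ : v ≡ (suc m * z₁ , suc m * z₂)) where

    private
      c : ℕ
      c = z₁ + z₂
      X Y : ℕ → ℕ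
      X i = proj₁ (node W i)
      Y i = proj₂ (node W i)

      n≡ : m * c + c ≡ n
      n≡ = trans (ℕP.+-comm (m * c) c) (sym (scaled-length W (suc m) z₁ z₂ v≡))

      f : ℕ → ℕ
      f t = X (t * c)

      f-end : f (suc m) ≡ f 0 + suc m * z₁
      f-end = begin
        X (suc m * c)       ≡⟨ cong X (trans (ℕP.+-comm c (m * c)) n≡) ⟩
        X n                 ≡⟨ cong proj₁ (trans (stop W) v≡) ⟩
        suc m * z₁          ≡⟨ cong (λ t → t + suc m * z₁) (cong proj₁ (start W)) ⟨
        X 0 + suc m * z₁    ∎
        where open ≡-Reasoning

      D E : ℕ → ℕ
      D i = X (i + c)
      E i = X i + z₁

      at-multiple : ∀ {t} → t ≤ m → t * c ≤ m * c
      at-multiple t≤m = ℕP.*-monoˡ-≤ c t≤m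

      D-steps : UnitSteps (m * c) D
      D-steps i i<B = first-coordinate-steps W (i + c)
                        (subst (i + c <_) n≡ (ℕP.+-monoˡ-< c i<B))

      E-steps : UnitSteps (m * c) E
      E-steps i i<B with first-coordinate-steps W i (ℕP.<-≤-trans i<B (subst (m * c ≤_) n≡ (ℕP.m≤m+n (m * c) c)))
      ... | inj₁ same = inj₁ (cong (_+ z₁) same)
      ... | inj₂ next = inj₂ (cong (_+ z₁) next)

      D-at : ∀ t → D (t * c) ≡ f (suc t)
      D-at t = cong X (ℕP.+-comm (t * c) c)

    chord : Chord W z₁ z₂
    chord with step-at-most f z₁ m (ℕP.≤-reflexive f-end) | step-at-least f z₁ m (ℕP.≤-reflexive (sym f-end))
    ... | t , t≤m , dip | t' , t'≤m , rise
      with crossing-below D E (at-multiple t≤m) (at-multiple t'≤m) D-steps E-steps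
             (subst (_≤ E (t * c)) (sym (D-at t)) dip) (subst (E (t' * c) ≤_) (sym (D-at t')) rise)
    ...   | j , j≤B , meet = record { j = j ; fits = j+c≤n ; x-shift = meet ; y-shift = y-meet }
      where
      open ≡-Reasoning
      j+c≤n : j + c ≤ n
      j+c≤n = subst (j + c ≤_) n≡ (ℕP.+-monoˡ-≤ c j≤B)
      -- the second coordinate follows since ‖node i‖₁ = i
      y-meet : Y (j + c) ≡ Y j + z₂
      y-meet = ℕP.+-cancelˡ-≡ (X j + z₁) (Y (j + c)) (Y j + z₂) (begin
        (X j + z₁) + Y (j + c)     ≡⟨ cong (_+ Y (j + c)) meet ⟨
        X (j + c) + Y (j + c)      ≡⟨ norm-node (node W) (start W) (step W) (j + c) j+c≤n ⟩
        j + c                      ≡⟨ cong (_+ c) (norm-node (node W) (start W) (step W) j (ℕP.≤-trans (ℕP.m≤m+n j c) j+c≤n)) ⟨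
        (X j + Y j) + (z₁ + z₂)    ≡⟨ shift-law (X j) (Y j) z₁ z₂ ⟩
        (X j + z₁) + (Y j + z₂)    ∎)

  -- If v = m·z with m ≥ 2 and z ∈ Λ, an avoiding walk to v is impossible: the
  -- chord theorem gives two nodes, not the two ends, that differ by z.
  no-proper-divisor : ∀ {Λ n v} (W : Walk (suc n) v) → Avoids Λ W →
                      ∀ m z₁ z₂ → 2 ≤ m → v ≡ (m * z₁ , m * z₂) → (+ z₁ , + z₂) ∈L Λ → ⊥
  no-proper-divisor {Λ} {n} W avoids (suc m) z₁ z₂ (s≤s 1≤m) v≡ z∈ =
    too-long (avoids (j + c) j (ℕP.m<m+n j 0<c) fits (subst (_∈L Λ) (sym gap) z∈))
    where
    open Chord (chord W m z₁ z₂ v≡)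
    c : ℕ
    c = z₁ + z₂
    n≡ : suc n ≡ suc m * c
    n≡ = scaled-length W (suc m) z₁ z₂ v≡
    0<c : 0 < c
    0<c = ℕP.n≢0⇒n>0 (λ c≡0 → ℕP.1+n≢0 (trans n≡ (trans (cong (suc m *_) c≡0) (ℕP.*-zeroʳ (suc m)))))
    shift : ∀ x z → + (x + z) ℤ.- + x ≡ + z
    shift x z = trans (pos-difference (ℕP.m≤m+n x z)) (cong +_ (ℕP.m+n∸m≡n x z))
    gap : diff (node W (j + c)) (node W j) ≡ (+ z₁ , + z₂)
    gap = cong₂ _,_ (trans (cong (λ x → + x ℤ.- + proj₁ (node W j)) x-shift) (shift (proj₁ (node W j)) z₁))
                    (trans (cong (λ y → + y ℤ.- + proj₂ (node W j)) y-shift) (shift (proj₂ (node W j)) z₂))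
    -- joining the two ends would force c = (m + 1)·c, i.e. m·c = 0
    ends-collapse : j + c ≡ suc n → j ≡ 0 → m * c ≡ 0
    ends-collapse j+c≡n j≡0 = ℕP.+-cancelˡ-≡ c (m * c) 0 (begin
      c + m * c   ≡⟨ n≡ ⟨
      suc n       ≡⟨ j+c≡n ⟨
      j + c       ≡⟨ cong (_+ c) j≡0 ⟩
      c           ≡⟨ ℕP.+-identityʳ c ⟨
      c + 0       ∎)
      where open ≡-Reasoning
    too-long : j + c ≡ suc n × j ≡ 0 → ⊥
    too-long (j+c≡n , j≡0) with ℕP.m*n≡0⇒m≡0∨n≡0 m (ends-collapse j+c≡n j≡0)
    ... | inj₁ m≡0 = ℕP.<⇒≱ 1≤m (ℕP.≤-reflexive m≡0)
    ... | inj₂ c≡0 = ℕP.<⇒≢ 0<c (sym c≡0)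

  -- The same with z ∈ ℤ²: v = m·z with v ∈ ℕ² forces z ∈ ℕ².
  no-lattice-divisor : ∀ {Λ n a b} (W : Walk (suc n) (a , b)) → Avoids Λ W →
                       ∀ m z → 2 ≤ m → z ∈L Λ → (+ a , + b) ≡ (+ m ℤ.* proj₁ z , + m ℤ.* proj₂ z) → ⊥
  no-lattice-divisor {Λ} W avoids m (z₁ , z₂) 2≤m z∈ v≡mz
    with natural-factor z₁ (ℕP.<-≤-trans (s≤s z≤n) 2≤m) (cong proj₁ v≡mz)
       | natural-factor z₂ (ℕP.<-≤-trans (s≤s z≤n) 2≤m) (cong proj₂ v≡mz)
  ... | z₁' , refl , a≡ | z₂' , refl , b≡ = no-proper-divisor {Λ} W avoids m z₁' z₂' 2≤m (cong₂ _,_ a≡ b≡) z∈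

  walk-visible : ∀ {Λ n v} (W : Walk n v) → Avoids Λ W → toℤ² v ∈L Λ → Visible Λ (toℤ² v)
  walk-visible {n = zero} W _ _ w _ on-segment =
    inj₁ (segment-of-origin w (subst (λ p → OnSegment w (toℤ² p)) (trans (sym (stop W)) (start W)) on-segment))
  walk-visible {Λ} {suc n} {a , b} W avoids v∈ w w∈ on-segment
    with segment-reduction Λ (+ a , + b) w v∈ w∈ on-segment
  ... | inj₁ w≡0 = inj₁ w≡0
  ... | inj₂ (inj₁ w≡v) = inj₂ w≡v
  ... | inj₂ (inj₂ (m , z , 2≤m , z∈ , v≡mz)) = ⊥-elim (no-lattice-divisor {Λ} W avoids m z 2≤m z∈ v≡mz)

module Sufficiency where

  open import Data.Nat as ℕ using (ℕ; zero; suc; _+_; _*_; _∸_; _<_; _≤_; _<?_; z≤n)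
  import Data.Nat.Properties as ℕP
  import Data.Nat.Tactic.RingSolver as ℕSolver
  open import Data.Integer as ℤ using (+_; 0ℤ)
  import Data.Integer.Properties as ℤP
  open import Data.Integer.Tactic.RingSolver using (solve-∀)
  open import Data.Product using (_×_; _,_; proj₁; proj₂)
  open import Data.Sum using (_⊎_; inj₁; inj₂)
  open import Data.Empty using (⊥-elim)
  open import Relation.Nullary using (yes; no)
  open import Relation.Binary.PropositionalEquality
  open Arithmetic
  open Lattices
  open Walks

  private
    collinear-law₁ : ∀ a b A B → (a ℤ.+ b) ℤ.* A ≡ (A ℤ.+ B) ℤ.* a ℤ.- (a ℤ.* B ℤ.- b ℤ.* A)
    collinear-law₁ = solve-∀

    collinear-law₂ : ∀ a b A B → (a ℤ.+ b) ℤ.* B ≡ (A ℤ.+ B) ℤ.* b ℤ.+ (a ℤ.* B ℤ.- b ℤ.* A)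
    collinear-law₂ = solve-∀

    difference-law : ∀ x y x' y' → (x ℤ.- x') ℤ.+ (y ℤ.- y') ≡ (x ℤ.+ y) ℤ.- (x' ℤ.+ y')
    difference-law = solve-∀

    cross-law : ∀ a b x y x' y' → a ℤ.* (y ℤ.- y') ℤ.- b ℤ.* (x ℤ.- x')
                                ≡ (a ℤ.* y ℤ.- b ℤ.* x) ℤ.- (a ℤ.* y' ℤ.- b ℤ.* x')
    cross-law = solve-∀

    cancel-law : ∀ p q → (p ℤ.+ q) ℤ.- p ≡ q
    cancel-law = solve-∀

    up-law : ∀ a b x r → a + (b * x + r) ≡ b * x + (r + a)
    up-law = ℕSolver.solve-∀

    right-law : ∀ b x r' → b * x + (b + r') ≡ (b + b * x) + r'
    right-law = ℕSolver.solve-∀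

    end-law₁ : ∀ a b y → y * (a + b) ≡ a * y + b * y
    end-law₁ = ℕSolver.solve-∀

    end-law₂ : ∀ b x y r → (b * x + r) + b * y ≡ r + b * (x + y)
    end-law₂ = ℕSolver.solve-∀

  -- A vector d parallel to v = (a, b) with coordinate sum k satisfies
  -- ‖v‖₁·d = k·v, so for k ≤ ‖v‖₁ it lies on the segment [0, v].
  parallel-on-segment : ∀ a b (d : ℤ²) k → cross (+ a , + b) d ≡ 0ℤ → proj₁ d ℤ.+ proj₂ d ≡ + k →
                        k ≤ a + b → 0 < a + b → OnSegment d (+ a , + b)
  parallel-on-segment a b (A , B) k cross≡0 sum≡k k≤N 0<N = k , a + b , k≤N , 0<N , on₁ , on₂
    where
    open ≡-Reasoning
    on₁ : + (a + b) ℤ.* A ≡ + k ℤ.* + a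
    on₁ = begin
      + (a + b) ℤ.* A                                    ≡⟨ cong (ℤ._* A) (ℤP.pos-+ a b) ⟩
      (+ a ℤ.+ + b) ℤ.* A                                ≡⟨ collinear-law₁ (+ a) (+ b) A B ⟩
      (A ℤ.+ B) ℤ.* + a ℤ.- cross (+ a , + b) (A , B)   ≡⟨ cong₂ (λ s t → s ℤ.* + a ℤ.- t) sum≡k cross≡0 ⟩
      + k ℤ.* + a ℤ.- 0ℤ                                 ≡⟨ ℤP.+-identityʳ (+ k ℤ.* + a) ⟩
      + k ℤ.* + a                                        ∎
    on₂ : + (a + b) ℤ.* B ≡ + k ℤ.* + b
    on₂ = begin
      + (a + b) ℤ.* B                                    ≡⟨ cong (ℤ._* B) (ℤP.pos-+ a b) ⟩
      (+ a ℤ.+ + b) ℤ.* B                                ≡⟨ collinear-law₂ (+ a) (+ b) A B ⟩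
      (A ℤ.+ B) ℤ.* + b ℤ.+ cross (+ a , + b) (A , B)   ≡⟨ cong₂ (λ s t → s ℤ.* + b ℤ.+ t) sum≡k cross≡0 ⟩
      + k ℤ.* + b ℤ.+ 0ℤ                                 ≡⟨ ℤP.+-identityʳ (+ k ℤ.* + b) ⟩
      + k ℤ.* + b                                        ∎

  difference-norm : ∀ {n v} (W : Walk n v) {i j} → j ≤ i → i ≤ n →
                    proj₁ (diff (node W i) (node W j)) ℤ.+ proj₂ (diff (node W i) (node W j)) ≡ + (i ∸ j)
  difference-norm {n} W {i} {j} j≤i i≤n =
    trans (difference-law (+ proj₁ (node W i)) (+ proj₂ (node W i)) (+ proj₁ (node W j)) (+ proj₂ (node W j)))
          (trans (cong₂ ℤ._-_ (norm i i≤n) (norm j (ℕP.≤-trans j≤i i≤n))) (pos-difference j≤i))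
    where
    norm : ∀ k → k ≤ n → + proj₁ (node W k) ℤ.+ + proj₂ (node W k) ≡ + k
    norm k k≤n = trans (sym (ℤP.pos-+ (proj₁ (node W k)) (proj₂ (node W k))))
                       (cong +_ (norm-node (node W) (start W) (step W) k k≤n))

  -- The lower Christoffel walk from 0 to (a, b): along the walk the remainder
  -- r = a·y - b·x stays in [0, a + b); step up if that keeps r < a + b,
  -- otherwise step right.
  module Christoffel (a b : ℕ) where

    N : ℕ
    N = a + b

    record State : Set where
      constructor ⟨_,_,_⟩
      field
        col row rem : ℕ

    open State public

    advance : State → State
    advance ⟨ x , y , r ⟩ with r + a <? N
    ... | yes _ = ⟨ x , suc y , r + a ⟩
    ... | no _  = ⟨ suc x , y , r + a ∸ N ⟩

    states : ℕ → State
    states zero    = ⟨ 0 , 0 , 0 ⟩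
    states (suc i) = advance (states i)

    point : ℕ → ℕ²
    point i = (col (states i) , row (states i))

    point-step : ∀ i → Step (point i) (point (suc i))
    point-step i with states i
    ... | ⟨ x , y , r ⟩ with r + a <? N
    ...   | yes _ = inj₂ refl
    ...   | no _  = inj₁ refl

    point-norm : ∀ i → ‖ point i ‖₁ ≡ i
    point-norm i = norm-node {n = i} point refl (λ k _ → point-step k) i ℕP.≤-refl

    Balanced : State → Set
    Balanced ⟨ x , y , r ⟩ = r < N × a * y ≡ b * x + r

    advance-balanced : ∀ s → Balanced s → Balanced (advance s)
    advance-balanced ⟨ x , y , r ⟩ (r<N , eq) with r + a <? N
    ... | yes r+a<N = r+a<N , trans (ℕP.*-suc a y) (trans (cong (λ t → a + t) eq) (up-law a b x r))
    ... | no r+a≮N = r'<N , (begin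
        a * y              ≡⟨ eq ⟩
        b * x + r          ≡⟨ cong (λ t → b * x + t) r≡b+r' ⟩
        b * x + (b + r')   ≡⟨ right-law b x r' ⟩
        (b + b * x) + r'   ≡⟨ cong (_+ r') (ℕP.*-suc b x) ⟨
        b * suc x + r'     ∎)
      where
      open ≡-Reasoning
      r' : ℕ
      r' = r + a ∸ N
      r≡b+r' : r ≡ b + r'
      r≡b+r' = ℕP.+-cancelˡ-≡ a r (b + r')
        (trans (ℕP.+-comm a r) (trans (sym (ℕP.m+[n∸m]≡n (ℕP.≮⇒≥ r+a≮N))) (ℕP.+-assoc a b r')))
      r'<N : r' < N
      r'<N = ℕP.≤-<-trans (subst (r' ≤_) (sym r≡b+r') (ℕP.m≤n+m r' b)) r<N

    balanced : 0 < N → ∀ i → Balanced (states i)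
    balanced 0<N zero    = 0<N , trans (ℕP.*-zeroʳ a) (sym (trans (ℕP.+-identityʳ (b * 0)) (ℕP.*-zeroʳ b)))
    balanced 0<N (suc i) = advance-balanced (states i) (balanced 0<N i)

    -- A balanced node of norm N is (a, b): there N·y = b·N + r with r < N.
    balanced-end : 0 < N → Balanced (states N) → point N ≡ (a , b)
    balanced-end 0<N (r<N , eq) = cong₂ _,_ x≡a y≡b
      where
      open ≡-Reasoning
      x y r : ℕ
      x = col (states N)
      y = row (states N)
      r = rem (states N)
      yN≡ : 0 + y * N ≡ r + b * N
      yN≡ = begin
        y * (a + b)            ≡⟨ end-law₁ a b y ⟩
        a * y + b * y          ≡⟨ cong (_+ b * y) eq ⟩
        (b * x + r) + b * y    ≡⟨ end-law₂ b x y r ⟩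
        r + b * (x + y)        ≡⟨ cong (λ t → r + b * t) (point-norm N) ⟩
        r + b * N              ∎
      y≡b : y ≡ b
      y≡b = proj₂ (digits-unique N {{ℕ.>-nonZero 0<N}} 0<N r<N yN≡)
      x≡a : x ≡ a
      x≡a = ℕP.+-cancelʳ-≡ b x a (trans (cong (λ t → x + t) (sym y≡b)) (point-norm N))

    point-end : point N ≡ (a , b)
    point-end with N ℕP.≟ 0
    ... | yes N≡0 = trans (cong point N≡0) (cong₂ _,_ (sym (ℕP.m+n≡0⇒m≡0 a N≡0)) (sym (ℕP.m+n≡0⇒n≡0 a N≡0)))
    ... | no N≢0 = balanced-end (ℕP.n≢0⇒n>0 N≢0) (balanced (ℕP.n≢0⇒n>0 N≢0) N)

    walk : Walk N (a , b)
    walk = record { node = point ; start = refl ; stop = point-end ; step = λ i _ → point-step i }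

    remainder : 0 < N → ∀ k → + a ℤ.* + row (states k) ℤ.- + b ℤ.* + col (states k) ≡ + rem (states k)
    remainder 0<N k = trans (cong (ℤ._- (+ b ℤ.* + x)) (begin
        + a ℤ.* + y          ≡⟨ ℤP.pos-* a y ⟨
        + (a * y)            ≡⟨ cong +_ (proj₂ (balanced 0<N k)) ⟩
        + (b * x + r)        ≡⟨ ℤP.pos-+ (b * x) r ⟩
        + (b * x) ℤ.+ + r    ≡⟨ cong (ℤ._+ + r) (ℤP.pos-* b x) ⟩
        + b ℤ.* + x ℤ.+ + r  ∎)) (cancel-law (+ b ℤ.* + x) (+ r))
      where
      open ≡-Reasoning
      x y r : ℕ
      x = col (states k)
      y = row (states k)
      r = rem (states k)

    -- Hence the cross product of v with a node difference is r_i - r_j,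
    -- which is smaller than N in absolute value.
    cross-difference : 0 < N → ∀ i j → ℤ.∣ cross (+ a , + b) (diff (point i) (point j)) ∣ < N
    cross-difference 0<N i j = begin-strict
      ℤ.∣ cross (+ a , + b) (diff (point i) (point j)) ∣  ≡⟨ cong ℤ.∣_∣ cross≡ ⟩
      ℤ.∣ + rᵢ ℤ.- + rⱼ ∣                                 ≡⟨ cong ℤ.∣_∣ (ℤP.[+m]-[+n]≡m⊖n rᵢ rⱼ) ⟩
      ℤ.∣ rᵢ ℤ.⊖ rⱼ ∣                                     ≤⟨ ℤP.∣m⊝n∣≤m⊔n rᵢ rⱼ ⟩
      rᵢ ℕ.⊔ rⱼ                                            <⟨ ℕP.⊔-lub (proj₁ (balanced 0<N i)) (proj₁ (balanced 0<N j)) ⟩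
      N                                                    ∎
      where
      open ℕP.≤-Reasoning
      rᵢ rⱼ : ℕ
      rᵢ = rem (states i)
      rⱼ = rem (states j)
      cross≡ : cross (+ a , + b) (diff (point i) (point j)) ≡ + rᵢ ℤ.- + rⱼ
      cross≡ = trans (cross-law (+ a) (+ b) _ _ _ _) (cong₂ ℤ._-_ (remainder 0<N i) (remainder 0<N j))

  -- For j < i ≤ N the node difference d is a lattice vector whose cross
  -- product with v is below vol Λ, so d is parallel to v and lies on [0, v];
  -- visibility then forces d = v, i.e. i = N and j = 0.
  christoffel-avoids : ∀ {Λ a b} → (+ a , + b) ∈L Λ → Visible Λ (+ a , + b) → a + b ≤ vol Λ →
                       Avoids Λ (Christoffel.walk a b)
  christoffel-avoids {Λ} {a} {b} v∈ visible N≤vol i j j<i i≤N d∈ =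
    conclude (visible d d∈ (parallel-on-segment a b d (i ∸ j) parallel sum≡ (ℕP.≤-trans (ℕP.m∸n≤m i j) i≤N) 0<N))
    where
    open Christoffel a b
    d : ℤ²
    d = diff (point i) (point j)
    0<N : 0 < N
    0<N = ℕP.<-≤-trans (ℕP.≤-<-trans z≤n j<i) i≤N
    parallel : cross (+ a , + b) d ≡ 0ℤ
    parallel = small-cross Λ (+ a , + b) d v∈ d∈ (ℕP.<-≤-trans (cross-difference 0<N i j) N≤vol)
    sum≡ : proj₁ d ℤ.+ proj₂ d ≡ + (i ∸ j)
    sum≡ = difference-norm walk (ℕP.<⇒≤ j<i) i≤N
    conclude : d ≡ (+ 0 , + 0) ⊎ d ≡ (+ a , + b) → i ≡ N × j ≡ 0
    conclude (inj₁ d≡0) = ⊥-elim (ℕP.<⇒≢ (ℕP.m<n⇒0<n∸m j<i)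
                            (sym (ℤP.+-injective (trans (sym sum≡) (cong (λ p → proj₁ p ℤ.+ proj₂ p) d≡0)))))
    conclude (inj₂ d≡v) = i≡N , j≡0
      where
      gap≡N : i ∸ j ≡ N
      gap≡N = ℤP.+-injective (trans (sym sum≡) (trans (cong (λ p → proj₁ p ℤ.+ proj₂ p) d≡v) (sym (ℤP.pos-+ a b))))
      i≡N : i ≡ N
      i≡N = ℕP.≤-antisym i≤N (subst (_≤ i) gap≡N (ℕP.m∸n≤m i j))
      j≡0 : j ≡ 0
      j≡0 = ℕP.+-cancelˡ-≡ i j 0 (begin
        i + j         ≡⟨ cong (_+ j) (trans i≡N (sym gap≡N)) ⟩
        (i ∸ j) + j   ≡⟨ ℕP.m∸n+n≡m (ℕP.<⇒≤ j<i) ⟩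
        i             ≡⟨ ℕP.+-identityʳ i ⟨
        i + 0         ∎)
        where open ≡-Reasoning

open import Function.Bundles using (mk⇔)
open import Data.Product using (_,_)
open import Relation.Binary.PropositionalEquality using (subst)
open Walks using (walk⇒goodPath; goodPath⇒walk; walk-length)
open Necessity using (walk-bound; walk-visible)
open Sufficiency using (module Christoffel; christoffel-avoids)

mainTheorem3 : (Λ : Lattice) (v : ℕ²) → toℤ² v ∈L Λ →
    GoodPath Λ v ⇔ (Visible Λ (toℤ² v) × ‖ v ‖₁ ≤ vol Λ)
mainTheorem3 Λ v@(a , b) v∈Λ = mk⇔ necessary sufficient
  where
  necessary : GoodPath Λ v → Visible Λ (toℤ² v) × ‖ v ‖₁ ≤ vol Λ
  necessary path with goodPath⇒walk {Λ} path
  ... | n , W , avoids = walk-visible {Λ} W avoids v∈Λ , subst (_≤ vol Λ) (walk-length W) (walk-bound {Λ} W avoids)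

  sufficient : Visible Λ (toℤ² v) × ‖ v ‖₁ ≤ vol Λ → GoodPath Λ v
  sufficient (visible , short) = walk⇒goodPath {Λ} (Christoffel.walk a b) (christoffel-avoids {Λ} v∈Λ visible short)
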